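{- Let $\Omega^{(1)},\dots,\Omega^{(\ell)}$ be a $(k,Q)$ family of $\ell$ sets. The number of ways of piercing this family with $s$ points is at most $(\ell k)^s$. Moreover, if $\ell\ge s+1$, then the number of ways of piercing it with $s$ points is at most $Qs(s+1)(\ell k)^{s-1}$.
   Context: A collection of $\ell$ sets is a $(k,Q)$ family if each set has size at most $k$ and the intersection of each pair of distinct sets has size at most $Q$. A set of points $p_1,\dots,p_s$ pierces a collection of sets if each set in the collection contains at least one of the points $p_i$; a "way of piercing with $s$ points" is such a set of $s$ points. -}

module Defs where

open import Data.Nat using (ℕ; _≤_)
open import Data.Fin using (Fin)
open import Data.Fin.Subset using (Subset; _∈_; _∩_; ∣_∣; Nonempty)
open import Data.Product using (∃; _×_)
open import Relation.Binary.PropositionalEquality using (_≡_; _≢_)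
open import Data.List using (List; length)
open import Data.List.Relation.Unary.All using (All)
open import Data.List.Relation.Unary.Unique.Propositional using (Unique)

Family : ℕ → ℕ → Set
Family n ℓ = Fin ℓ → Subset n

IsKQFamily : ∀ {n ℓ} → ℕ → ℕ → Family n ℓ → Set
IsKQFamily {ℓ = ℓ} k Q Ω =
  (∀ (i : Fin ℓ) → ∣ Ω i ∣ ≤ k) ×
  (∀ (i j : Fin ℓ) → i ≢ j → ∣ Ω i ∩ Ω j ∣ ≤ Q)

PiercesWith : ∀ {n ℓ} → ℕ → Family n ℓ → Subset n → Set
PiercesWith {n} {ℓ} s Ω P =
  (∣ P ∣ ≡ s) ×
  (∀ (x : Fin n) → x ∈ P → ∃ λ (i : Fin ℓ) → x ∈ Ω i) ×
  (∀ (i : Fin ℓ) → Nonempty (Ω i ∩ P))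

-- "The number of ways of piercing Ω with s points is at most B":
-- every duplicate-free list of such piercing sets has length ≤ B.
NumPiercingsAtMost : ∀ {n ℓ} → ℕ → Family n ℓ → ℕ → Set
NumPiercingsAtMost {n} s Ω B =
  ∀ (Ps : List (Subset n)) → Unique Ps → All (PiercesWith s Ω) Ps → length Ps ≤ B

-- A piercing set P of s points is determined by the list of its points, a
-- sequence of length s over the list U of all points of the family (counted
-- with multiplicity), and ∣ U ∣ ≤ ℓ k; this gives (ℓ k)^s. If ℓ ≥ s + 1, the
-- first s + 1 sets are pierced by only s points, so by pigeonhole two of
-- them, Ω⁽ⁱ⁾ and Ω⁽ʲ⁾, share a point x of P. Then P = {x} ∪ R with x in
-- Ω⁽ⁱ⁾ ∩ Ω⁽ʲ⁾ (at most Q choices), R a sequence of length s − 1 over U, and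
-- (i, j) one of (s + 1) s ordered pairs.
module Submission where

open import Defs
open import Data.Nat using (ℕ; _≤_; _+_; _*_; _^_; _∸_)
open import Data.Product using (_×_)

open import Data.Nat using (zero; suc; z≤n; s≤s; _<_)
open import Data.Nat.Properties
  using (+-comm; ≤-refl; ≤-trans; ≤-reflexive; +-mono-≤; *-monoˡ-≤; *-monoʳ-≤; ^-monoˡ-≤; module ≤-Reasoning)
open import Data.Nat.Solver using (module +-*-Solver)
open import Data.Fin as Fin using (Fin; punchIn; punchOut; inject≤)
import Data.Fin.Properties as Finₚ
open import Data.Fin.Subset as Subset using (Subset; inside; outside; ⁅_⁆; _∪_; _∩_; ∣_∣; Nonempty)
import Data.Fin.Subset.Properties as Subsetₚ
open import Data.Vec using ([]; _∷_; here; there)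
open import Data.List using (List; []; _∷_; [_]; _++_; length; lookup; map; concatMap; foldr; allFin)
open import Data.List.Properties using (length-map; length-++; length-++-sucʳ; length-tabulate)
open import Data.List.Relation.Unary.All as All using (All; []; _∷_)
open import Data.List.Relation.Unary.Any as Any using (here; there)
open import Data.List.Relation.Unary.Any.Properties using (lookup-index)
open import Data.List.Relation.Unary.Unique.Propositional using (Unique)
open import Data.List.Relation.Unary.AllPairs using (_∷_)
open import Data.List.Membership.Propositional using () renaming (_∈_ to _∈ₗ_)
open import Data.List.Membership.Propositional.Properties
  using (∈-map⁺; ∈-map⁻; ∈-concatMap⁺; ∈-∃++; ∈-allFin)
open import Data.List.Relation.Binary.Permutation.Propositional using (_↭_; ↭-sym; ↭-trans; ↭-reflexive)
open import Data.List.Relation.Binary.Permutation.Propositional.Properties using (∈-resp-↭; shift)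
open import Data.Product using (∃; ∃₂; _,_; proj₁; proj₂)
open import Data.Sum using (inj₁; inj₂)
open import Relation.Binary.PropositionalEquality using (_≡_; _≢_; refl; sym; trans; cong; subst; module ≡-Reasoning)
open import Relation.Nullary using (contradiction)
open import Function using (_∘_)

private
  variable
    A B : Set
    n m ℓ k Q s : ℕ

length-concatMap-≤ : ∀ c (f : A → List B) xs → (∀ x → length (f x) ≤ c) →
                     length (concatMap f xs) ≤ length xs * c
length-concatMap-≤ c f []       f≤c = z≤n
length-concatMap-≤ c f (x ∷ xs) f≤c = begin
  length (f x ++ concatMap f xs)          ≡⟨ length-++ (f x) ⟩
  length (f x) + length (concatMap f xs)  ≤⟨ +-mono-≤ (f≤c x) (length-concatMap-≤ c f xs f≤c) ⟩
  c + length xs * c                       ∎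
  where open ≤-Reasoning

∈-concatMap⁺′ : ∀ {f : A → List B} {x xs y} → x ∈ₗ xs → y ∈ₗ f x → y ∈ₗ concatMap f xs
∈-concatMap⁺′ {f = f} x∈xs y∈fx = ∈-concatMap⁺ f (Any.map (λ { refl → y∈fx }) x∈xs)

length-concatMap-allFin-≤ : ∀ {c} (f : Fin n → List A) → (∀ i → length (f i) ≤ c) →
                            length (concatMap f (allFin n)) ≤ n * c
length-concatMap-allFin-≤ {n = n} {c = c} f f≤c =
  subst (λ l → length (concatMap f (allFin n)) ≤ l * c) (length-tabulate {n = n} (λ i → i))
        (length-concatMap-≤ c f (allFin n) f≤c)

Unique⇒length≤ : ∀ {xs ys : List A} → Unique xs → All (_∈ₗ ys) xs → length xs ≤ length ys
Unique⇒length≤ {xs = []}     _             _            = z≤n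
Unique⇒length≤ {xs = x ∷ xs} (x∉xs ∷ uniq) (x∈ys ∷ xs⊆ys)
  with pre , post , refl ← ∈-∃++ x∈ys =
  ≤-trans (s≤s (Unique⇒length≤ uniq (All.zipWith (λ (x≢y , y∈ys) → drop-x x≢y y∈ys)
                                                  (x∉xs , xs⊆ys))))
          (≤-reflexive (sym (length-++-sucʳ pre x post)))
  where
  drop-x : ∀ {y} → x ≢ y → y ∈ₗ pre ++ [ x ] ++ post → y ∈ₗ pre ++ post
  drop-x x≢y y∈ with ∈-resp-↭ (shift x pre post) y∈
  ... | here refl = contradiction refl x≢y
  ... | there y∈′ = y∈′

pigeonhole-∈ : ∀ {xs : List A} (f : Fin m → A) → (∀ i → f i ∈ₗ xs) → length xs < m →
               ∃₂ λ i j → i ≢ j × f i ≡ f j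
pigeonhole-∈ {xs = xs} f f∈xs len<m
  with i , j , i<j , eq ← Finₚ.pigeonhole len<m (λ i → Any.index (f∈xs i)) =
  i , j , Finₚ.<⇒≢ i<j , (begin
    f i                             ≡⟨ lookup-index (f∈xs i) ⟩
    lookup xs (Any.index (f∈xs i))  ≡⟨ cong (lookup xs) eq ⟩
    lookup xs (Any.index (f∈xs j))  ≡⟨ lookup-index (f∈xs j) ⟨
    f j                             ∎)
  where open ≡-Reasoning

sequences : List A → ℕ → List (List A)
sequences xs zero    = [ [] ]
sequences xs (suc t) = concatMap (λ x → map (x ∷_) (sequences xs t)) xs

length-sequences : ∀ (xs : List A) t → length (sequences xs t) ≤ length xs ^ t
length-sequences xs zero    = ≤-refl
length-sequences xs (suc t) = length-concatMap-≤ _ _ xs λ x →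
  ≤-trans (≤-reflexive (length-map (x ∷_) (sequences xs t))) (length-sequences xs t)

∈-sequences : ∀ {xs ys : List A} → All (_∈ₗ xs) ys → ys ∈ₗ sequences xs (length ys)
∈-sequences []              = here refl
∈-sequences (y∈xs ∷ ys⊆xs) = ∈-concatMap⁺′ y∈xs (∈-map⁺ (_ ∷_) (∈-sequences ys⊆xs))

elements : Subset n → List (Fin n)
elements []            = []
elements (inside ∷ p)  = Fin.zero ∷ map Fin.suc (elements p)
elements (outside ∷ p) = map Fin.suc (elements p)

length-elements : ∀ (p : Subset n) → length (elements p) ≡ ∣ p ∣
length-elements []            = refl
length-elements (inside ∷ p)  = cong suc (trans (length-map Fin.suc (elements p)) (length-elements p))
length-elements (outside ∷ p) = trans (length-map Fin.suc (elements p)) (length-elements p)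

∈-elements⁺ : ∀ {x : Fin n} {p} → x Subset.∈ p → x ∈ₗ elements p
∈-elements⁺ {p = inside ∷ p}  here        = here refl
∈-elements⁺ {p = inside ∷ p}  (there x∈p) = there (∈-map⁺ Fin.suc (∈-elements⁺ x∈p))
∈-elements⁺ {p = outside ∷ p} (there x∈p) = ∈-map⁺ Fin.suc (∈-elements⁺ x∈p)

∈-elements⁻ : ∀ {x : Fin n} p → x ∈ₗ elements p → x Subset.∈ p
∈-elements⁻ (inside ∷ p) (here refl) = here
∈-elements⁻ (inside ∷ p) (there x∈)
  with _ , y∈ , refl ← ∈-map⁻ Fin.suc x∈ = there (∈-elements⁻ p y∈)
∈-elements⁻ (outside ∷ p) x∈
  with _ , y∈ , refl ← ∈-map⁻ Fin.suc x∈ = there (∈-elements⁻ p y∈)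

fromList : List (Fin n) → Subset n
fromList = foldr (λ x p → ⁅ x ⁆ ∪ p) Subset.⊥

∈-fromList⁺ : ∀ {x : Fin n} {xs} → x ∈ₗ xs → x Subset.∈ fromList xs
∈-fromList⁺ (here refl) = Subsetₚ.x∈p∪q⁺ (inj₁ (Subsetₚ.x∈⁅x⁆ _))
∈-fromList⁺ (there x∈)  = Subsetₚ.x∈p∪q⁺ (inj₂ (∈-fromList⁺ x∈))

∈-fromList⁻ : ∀ {x : Fin n} xs → x Subset.∈ fromList xs → x ∈ₗ xs
∈-fromList⁻ []       x∈ = contradiction x∈ Subsetₚ.∉⊥
∈-fromList⁻ (y ∷ xs) x∈ with Subsetₚ.x∈p∪q⁻ ⁅ y ⁆ (fromList xs) x∈
... | inj₁ x∈⁅y⁆ = here (Subsetₚ.x∈⁅y⁆⇒x≡y y x∈⁅y⁆)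
... | inj₂ x∈xs  = there (∈-fromList⁻ xs x∈xs)

fromList-elements : ∀ (p : Subset n) → fromList (elements p) ≡ p
fromList-elements p = Subsetₚ.⊆-antisym
  (λ x∈ → ∈-elements⁻ p (∈-fromList⁻ (elements p) x∈))
  (λ x∈ → ∈-fromList⁺ (∈-elements⁺ x∈))

fromList-resp-↭ : ∀ {xs ys : List (Fin n)} → xs ↭ ys → fromList xs ≡ fromList ys
fromList-resp-↭ {xs = xs} {ys} xs↭ys = Subsetₚ.⊆-antisym
  (λ x∈ → ∈-fromList⁺ (∈-resp-↭ xs↭ys (∈-fromList⁻ xs x∈)))
  (λ x∈ → ∈-fromList⁺ (∈-resp-↭ (↭-sym xs↭ys) (∈-fromList⁻ ys x∈)))

x∈p⇒p≡⁅x⁆∪rest : ∀ {x : Fin n} {p} → x Subset.∈ p →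
           ∃ λ rest → suc (length rest) ≡ ∣ p ∣ × p ≡ ⁅ x ⁆ ∪ fromList rest × All (Subset._∈ p) rest
x∈p⇒p≡⁅x⁆∪rest {x = x} {p} x∈p with pre , post , eq ← ∈-∃++ (∈-elements⁺ x∈p) =
  pre ++ post , size , sym p≡ , All.tabulate (λ y∈ → ∈-elements⁻ p (∈-resp-↭ x∷rest↭p (there y∈)))
  where
  open ≡-Reasoning
  x∷rest↭p : x ∷ pre ++ post ↭ elements p
  x∷rest↭p = ↭-trans (↭-sym (shift x pre post)) (↭-reflexive (sym eq))
  size : suc (length (pre ++ post)) ≡ ∣ p ∣
  size = begin
    suc (length (pre ++ post))     ≡⟨ length-++-sucʳ pre x post ⟨
    length (pre ++ [ x ] ++ post)  ≡⟨ cong length eq ⟨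
    length (elements p)            ≡⟨ length-elements p ⟩
    ∣ p ∣                          ∎
  p≡ : ⁅ x ⁆ ∪ fromList (pre ++ post) ≡ p
  p≡ = trans (fromList-resp-↭ x∷rest↭p) (fromList-elements p)

subsetsFrom : List (Fin n) → ℕ → List (Subset n)
subsetsFrom U t = map fromList (sequences U t)

length-subsetsFrom : ∀ (U : List (Fin n)) t → length (subsetsFrom U t) ≤ length U ^ t
length-subsetsFrom U t =
  ≤-trans (≤-reflexive (length-map fromList (sequences U t))) (length-sequences U t)

∈-subsetsFrom : ∀ {U ys : List (Fin n)} {t} → All (_∈ₗ U) ys → length ys ≡ t →
                fromList ys ∈ₗ subsetsFrom U t
∈-subsetsFrom ys⊆U refl = ∈-map⁺ fromList (∈-sequences ys⊆U)

subsetsThrough : List (Fin n) → ℕ → Fin n → List (Subset n)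
subsetsThrough U t x = map (⁅ x ⁆ ∪_) (subsetsFrom U t)

subsetsThroughPair : (A : Fin (suc m) → Subset n) → List (Fin n) → ℕ →
                     Fin (suc m) → Fin m → List (Subset n)
subsetsThroughPair A U t i j = concatMap (subsetsThrough U t) (elements (A i ∩ A (punchIn i j)))

-- (i , punchIn i j) runs over the (m + 1) m ordered pairs of distinct indices.
subsetsThroughPairs : (A : Fin (suc m) → Subset n) → List (Fin n) → ℕ → List (Subset n)
subsetsThroughPairs {m = m} A U t =
  concatMap (λ i → concatMap (subsetsThroughPair A U t i) (allFin m)) (allFin (suc m))

length-subsetsThroughPairs : ∀ (A : Fin (suc m) → Subset n) U t →
                             (∀ i j → ∣ A i ∩ A (punchIn i j) ∣ ≤ Q) →
                             length (subsetsThroughPairs A U t) ≤ suc m * (m * (Q * length U ^ t))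
length-subsetsThroughPairs {m = m} {Q = Q} A U t ∣A∩A∣≤Q =
  length-concatMap-allFin-≤ (λ i → concatMap (subsetsThroughPair A U t i) (allFin m)) λ i →
  length-concatMap-allFin-≤ (subsetsThroughPair A U t i) λ j →
  let shared = A i ∩ A (punchIn i j) in
  ≤-trans (length-concatMap-≤ (length U ^ t) (subsetsThrough U t) (elements shared) subsetsThrough≤)
          (*-monoˡ-≤ _ (≤-trans (≤-reflexive (length-elements shared)) (∣A∩A∣≤Q i j)))
  where
  subsetsThrough≤ : ∀ x → length (subsetsThrough U t x) ≤ length U ^ t
  subsetsThrough≤ x =
    ≤-trans (≤-reflexive (length-map (⁅ x ⁆ ∪_) (subsetsFrom U t))) (length-subsetsFrom U t)

∈-subsetsThroughPairs : ∀ (A : Fin (suc m) → Subset n) {U rest t i j x} →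
                        x Subset.∈ A i ∩ A (punchIn i j) → All (_∈ₗ U) rest → length rest ≡ t →
                        ⁅ x ⁆ ∪ fromList rest ∈ₗ subsetsThroughPairs A U t
∈-subsetsThroughPairs A {i = i} {j} x∈ rest⊆U len =
  ∈-concatMap⁺′ (∈-allFin i) (∈-concatMap⁺′ (∈-allFin j)
    (∈-concatMap⁺′ (∈-elements⁺ x∈) (∈-map⁺ (⁅ _ ⁆ ∪_) (∈-subsetsFrom rest⊆U len))))

points : Family n ℓ → List (Fin n)
points {ℓ = ℓ} Ω = concatMap (elements ∘ Ω) (allFin ℓ)

length-points : ∀ (Ω : Family n ℓ) → (∀ i → ∣ Ω i ∣ ≤ k) → length (points Ω) ≤ ℓ * k
length-points Ω ∣Ω∣≤k = length-concatMap-allFin-≤ (elements ∘ Ω) λ i →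
  ≤-trans (≤-reflexive (length-elements (Ω i))) (∣Ω∣≤k i)

∈-points : ∀ {Ω : Family n ℓ} {x i} → x Subset.∈ Ω i → x ∈ₗ points Ω
∈-points {i = i} x∈Ωi = ∈-concatMap⁺′ (∈-allFin i) (∈-elements⁺ x∈Ωi)

piercing-⊆-points : ∀ {Ω : Family n ℓ} {P x} → PiercesWith s Ω P → x Subset.∈ P → x ∈ₗ points Ω
piercing-⊆-points {Ω = Ω} (_ , P⊆⋃Ω , _) x∈P = ∈-points {Ω = Ω} (proj₂ (P⊆⋃Ω _ x∈P))

numPiercingsAtMost-byCandidates : ∀ {Ω : Family n ℓ} {b} (L : List (Subset n)) →
  (∀ {P} → PiercesWith s Ω P → P ∈ₗ L) → length L ≤ b → NumPiercingsAtMost s Ω b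
numPiercingsAtMost-byCandidates L piercing∈L ∣L∣≤b Ps uniq piercing =
  ≤-trans (Unique⇒length≤ uniq (All.map piercing∈L piercing)) ∣L∣≤b

pigeonhole-piercing : ∀ (A : Fin (suc m) → Subset n) {P} → ∣ P ∣ ≤ m → (∀ i → Nonempty (A i ∩ P)) →
                      ∃₂ λ i j → Nonempty ((A i ∩ A (punchIn i j)) ∩ P)
pigeonhole-piercing {m = m} A {P} ∣P∣≤m pierced =
  collision (pigeonhole-∈ p (λ i → ∈-elements⁺ (p∈P i))
                          (s≤s (≤-trans (≤-reflexive (length-elements P)) ∣P∣≤m)))
  where
  p : Fin (suc m) → Fin _
  p i = proj₁ (pierced i)
  p∈A : ∀ i → p i Subset.∈ A i
  p∈A i = proj₁ (Subsetₚ.x∈p∩q⁻ (A i) P (proj₂ (pierced i)))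
  p∈P : ∀ i → p i Subset.∈ P
  p∈P i = proj₂ (Subsetₚ.x∈p∩q⁻ (A i) P (proj₂ (pierced i)))
  collision : (∃₂ λ i j → i ≢ j × p i ≡ p j) → ∃₂ λ i j → Nonempty ((A i ∩ A (punchIn i j)) ∩ P)
  collision (i , j , i≢j , pᵢ≡pⱼ) =
    i , punchOut i≢j , p i , Subsetₚ.x∈p∩q⁺ (Subsetₚ.x∈p∩q⁺ (p∈A i , pᵢ∈Aⱼ) , p∈P i)
    where
    pᵢ∈Aⱼ : p i Subset.∈ A (punchIn i (punchOut i≢j))
    pᵢ∈Aⱼ rewrite Finₚ.punchIn-punchOut i≢j | pᵢ≡pⱼ = p∈A j

numPiercingsAtMost-[ℓk]^s : ∀ (Ω : Family n ℓ) → (∀ i → ∣ Ω i ∣ ≤ k) →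
                            NumPiercingsAtMost s Ω ((ℓ * k) ^ s)
numPiercingsAtMost-[ℓk]^s {s = s} Ω ∣Ω∣≤k =
  numPiercingsAtMost-byCandidates (subsetsFrom (points Ω) s) piercing∈
    (≤-trans (length-subsetsFrom (points Ω) s) (^-monoˡ-≤ s (length-points Ω ∣Ω∣≤k)))
  where
  piercing∈ : ∀ {P} → PiercesWith s Ω P → P ∈ₗ subsetsFrom (points Ω) s
  piercing∈ {P} piercing@(∣P∣≡s , _ , _) =
    subst (_∈ₗ subsetsFrom (points Ω) s) (fromList-elements P)
      (∈-subsetsFrom (All.tabulate (piercing-⊆-points {Ω = Ω} piercing ∘ ∈-elements⁻ P))
                     (trans (length-elements P) ∣P∣≡s))

numPiercingsAtMost-Qs[s+1][ℓk]^[s∸1] :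
  ∀ (Ω : Family n ℓ) → IsKQFamily k Q Ω → s + 1 ≤ ℓ →
  NumPiercingsAtMost s Ω (Q * s * (s + 1) * (ℓ * k) ^ (s ∸ 1))
numPiercingsAtMost-Qs[s+1][ℓk]^[s∸1] {ℓ = ℓ} {k = k} {Q = Q} {s = s} Ω (∣Ω∣≤k , ∣Ω∩Ω∣≤Q) s+1≤ℓ =
  numPiercingsAtMost-byCandidates candidates piercing∈ (begin
    length candidates                                ≤⟨ length-subsetsThroughPairs Ω′ (points Ω) (s ∸ 1) ∣Ω′∩Ω′∣≤Q ⟩
    suc s * (s * (Q * length (points Ω) ^ (s ∸ 1)))  ≤⟨ *-monoʳ-≤ (suc s) (*-monoʳ-≤ s (*-monoʳ-≤ Q
                                                          (^-monoˡ-≤ (s ∸ 1) (length-points Ω ∣Ω∣≤k)))) ⟩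
    suc s * (s * (Q * (ℓ * k) ^ (s ∸ 1)))            ≡⟨ rearrange s Q ((ℓ * k) ^ (s ∸ 1)) ⟩
    Q * s * (s + 1) * (ℓ * k) ^ (s ∸ 1)              ∎)
  where
  open ≤-Reasoning
  open +-*-Solver
  rearrange : ∀ s Q X → suc s * (s * (Q * X)) ≡ Q * s * (s + 1) * X
  rearrange = solve 3 (λ s Q X → (con 1 :+ s) :* (s :* (Q :* X)) := Q :* s :* (s :+ con 1) :* X) refl
  s+1≤ℓ′ : suc s ≤ ℓ
  s+1≤ℓ′ = subst (_≤ ℓ) (+-comm s 1) s+1≤ℓ
  Ω′ : Fin (suc s) → Subset _
  Ω′ i = Ω (inject≤ i s+1≤ℓ′)
  ∣Ω′∩Ω′∣≤Q : ∀ i j → ∣ Ω′ i ∩ Ω′ (punchIn i j) ∣ ≤ Q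
  ∣Ω′∩Ω′∣≤Q i j = ∣Ω∩Ω∣≤Q _ _ λ eq →
    Finₚ.punchInᵢ≢i i j (sym (Finₚ.inject≤-injective s+1≤ℓ′ s+1≤ℓ′ i (punchIn i j) eq))
  candidates : List (Subset _)
  candidates = subsetsThroughPairs Ω′ (points Ω) (s ∸ 1)
  piercing∈ : ∀ {P} → PiercesWith s Ω P → P ∈ₗ candidates
  piercing∈ {P} piercing@(∣P∣≡s , _ , pierced)
    with i , j , x , x∈ ← pigeonhole-piercing Ω′ (≤-reflexive ∣P∣≡s) (pierced ∘ λ i → inject≤ i s+1≤ℓ′)
    with x∈Ω′∩Ω′ , x∈P ← Subsetₚ.x∈p∩q⁻ _ P x∈
    with rest , ∣rest∣+1≡∣P∣ , P≡x∪rest , rest⊆P ← x∈p⇒p≡⁅x⁆∪rest x∈P =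
    subst (_∈ₗ candidates) (sym P≡x∪rest)
      (∈-subsetsThroughPairs Ω′ x∈Ω′∩Ω′ (All.map (piercing-⊆-points {Ω = Ω} piercing) rest⊆P)
                             (cong (_∸ 1) (trans ∣rest∣+1≡∣P∣ ∣P∣≡s)))

lemma6p4 : ∀ (n ℓ k Q s : ℕ) (Ω : Family n ℓ) → IsKQFamily k Q Ω →
    NumPiercingsAtMost s Ω ((ℓ * k) ^ s) ×
    (s + 1 ≤ ℓ → NumPiercingsAtMost s Ω (Q * s * (s + 1) * (ℓ * k) ^ (s ∸ 1)))
lemma6p4 n ℓ k Q s Ω kq@(∣Ω∣≤k , _) =
  numPiercingsAtMost-[ℓk]^s Ω ∣Ω∣≤k , numPiercingsAtMost-Qs[s+1][ℓk]^[s∸1] Ω kq
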